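{- Let $(p,R)$ be a mesh pattern with $p\in\mathfrak{S}_k$. (a) If $R'\subseteq R$, then every enclosed diagonal of the mesh pattern $(p,R')$ is an enclosed diagonal of $(p,R)$. (b) Each square in $R$ belongs to at most one enclosed diagonal of $(p,R)$.
   Context: A mesh pattern is a pair $(p,R)$ where $p\in\mathfrak{S}_k$ is a permutation and $R$ is a subset of the $(k+1)^2$ unit squares of $[0,k+1]^2$; a square is indexed by its lower-left corner, so $(a,b)\in R$ denotes $[a,a+1]\times[b,b+1]$, $a,b\in\{0,\dots,k\}$. The graph of $p$ is $G(p)=\{(i,p(i)) : i\in[1,k]\}$. Enclosed diagonals of $(p,R)$: for integers $a,b\ge 0$ and $c\ge 1$, the set $D=\{(a+i,b+i): i\in[0,c]\}\subseteq R$ is an enclosed NE-diagonal if $\{(a+i,b+i): i\in[0,c+1]\}\cap G(p)=\{(a+i,b+i): i\in[1,c]\}$ (these are lattice points), and $D=\{(a+i,b-i): i\in[0,c]\}\subseteq R$ is an enclosed SE-diagonal if $\{(a+i,b+1-i): i\in[0,c+1]\}\cap G(p)=\{(a+i,b+1-i): i\in[1,c]\}$. In addition, a single square $(a,b)\in R$ none of whose four corners $(a,b),(a+1,b),(a,b+1),(a+1,b+1)$ lies in $G(p)$ (a "pointless" square) is an enclosed diagonal of length $1$ (it is both an enclosed NE-diagonal and an enclosed SE-diagonal with $c=0$). An enclosed diagonal is a set $D$ of either of these types. -}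

module Defs where

open import Level using (0ℓ)
open import Data.Nat using (ℕ; zero; suc; _+_; _∸_; _≤_; _<_)
open import Data.Fin using (Fin; toℕ; fromℕ<)
open import Data.Fin.Permutation using (Permutation′; _⟨$⟩ʳ_)
open import Data.Bool using (Bool; true)
open import Data.Product using (Σ; _×_; _,_; ∃)
open import Data.Sum using (_⊎_)
open import Relation.Unary using (Pred)
open import Relation.Binary.PropositionalEquality using (_≡_)
open import Function.Bundles using (_⇔_)
open import Relation.Nullary using (¬_)

-- A square of [0,k+1]^2 is indexed by its lower-left corner (a,b) ∈ ℕ × ℕ.
Square : Set
Square = ℕ × ℕ

Shading : ℕ → Set
Shading k = Fin (suc k) → Fin (suc k) → Bool

MeshPattern : ℕ → Set
MeshPattern k = Permutation′ k × Shading k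

_⊆ₛ_ : ∀ {k} → Shading k → Shading k → Set
R' ⊆ₛ R = ∀ a b → R' a b ≡ true → R a b ≡ true

InR : ∀ {k} → Shading k → ℕ → ℕ → Set
InR {k} R a b = Σ (a < suc k) λ a< → Σ (b < suc k) λ b< → R (fromℕ< a<) (fromℕ< b<) ≡ true

-- The lattice point (x,y) lies in the graph G(p) = {(i,p(i)) : i ∈ [1,k]}
-- (Fin k is 0-based, hence the shifts by one).
InGraph : ∀ {k} → Permutation′ k → ℕ → ℕ → Set
InGraph {k} p x y = Σ (Fin k) λ i → (x ≡ suc (toℕ i)) × (y ≡ suc (toℕ (p ⟨$⟩ʳ i)))

_≐_ : Pred Square 0ℓ → Pred Square 0ℓ → Set
D ≐ E = (∀ s → D s → E s) × (∀ s → E s → D s)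

NESet : ℕ → ℕ → ℕ → Pred Square 0ℓ
NESet a b c (x , y) = Σ ℕ λ i → (i ≤ c) × (x ≡ a + i) × (y ≡ b + i)

SESet : ℕ → ℕ → ℕ → Pred Square 0ℓ
SESet a b c (x , y) = Σ ℕ λ i → (i ≤ c) × (x ≡ a + i) × (y + i ≡ b)

Singleton : ℕ → ℕ → Pred Square 0ℓ
Singleton a b (x , y) = (x ≡ a) × (y ≡ b)

IsEnclosedNE : ∀ {k} → MeshPattern k → ℕ → ℕ → ℕ → Set
IsEnclosedNE (p , R) a b c =
  (1 ≤ c) ×
  (∀ i → i ≤ c → InR R (a + i) (b + i)) ×
  (∀ i → i ≤ suc c → (InGraph p (a + i) (b + i) ⇔ ((1 ≤ i) × (i ≤ c))))

-- D = {(a+i,b-i) : i∈[0,c]} ⊆ R is an enclosed SE-diagonal (c ≥ 1);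
-- c ≤ b expresses that all these squares have nonnegative coordinates.
IsEnclosedSE : ∀ {k} → MeshPattern k → ℕ → ℕ → ℕ → Set
IsEnclosedSE (p , R) a b c =
  (1 ≤ c) × (c ≤ b) ×
  (∀ i → i ≤ c → InR R (a + i) (b ∸ i)) ×
  (∀ i → i ≤ suc c → (InGraph p (a + i) (suc b ∸ i) ⇔ ((1 ≤ i) × (i ≤ c))))

IsPointless : ∀ {k} → MeshPattern k → ℕ → ℕ → Set
IsPointless (p , R) a b =
  InR R a b ×
  ¬ InGraph p a b × ¬ InGraph p (suc a) b ×
  ¬ InGraph p a (suc b) × ¬ InGraph p (suc a) (suc b)

EnclosedDiagonal : ∀ {k} → MeshPattern k → Pred Square 0ℓ → Set
EnclosedDiagonal P D =
  (Σ ℕ λ a → Σ ℕ λ b → Σ ℕ λ c → IsEnclosedNE P a b c × (D ≐ NESet a b c)) ⊎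
  (Σ ℕ λ a → Σ ℕ λ b → Σ ℕ λ c → IsEnclosedSE P a b c × (D ≐ SESet a b c)) ⊎
  (Σ ℕ λ a → Σ ℕ λ b → IsPointless P a b × (D ≐ Singleton a b))

module Submission where

-- Part (a) is immediate: the conditions defining an enclosed diagonal mention
-- the shading only through "these squares lie in R", which is monotone in R.
--
-- Part (b) rests on two observations about the graph G(p) of a permutation.
--   * Runs.  Along a fixed diagonal line, an enclosed diagonal is a maximal
--     run of graph points: the graph holds at positions 1..c of a window
--     [0, c+1] and fails at both ends.  A run of a predicate on ℕ cannot
--     start inside another one, so two runs whose windows overlap coincide
--     (run-unique).  This settles two NE-diagonals, resp. two SE-diagonals,
--     through a common square; the only bookkeeping is to express the later
--     diagonal in the coordinates along the line of the earlier one.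
--   * Corners.  Every square of an enclosed NE-diagonal has its lower-left or
--     upper-right corner in G(p); every square of an SE-diagonal has its
--     upper-left or lower-right corner in G(p); a pointless square has none.
--     Since G(p) is the graph of an injective function, no square has both an
--     NE-corner and an SE-corner in G(p) (corners-clash).  This rules out two
--     enclosed diagonals of different kinds through a common square.

open import Defs
open import Data.Nat using (ℕ; zero; suc; _+_; _∸_; _≤_; z≤n; s≤s)
open import Data.Nat.Properties
open import Data.Fin using (toℕ)
open import Data.Fin.Properties using (toℕ-injective)
open import Data.Fin.Permutation using (Permutation′; _⟨$⟩ʳ_)
open import Data.Product using (_×_; _,_; proj₁; proj₂; Σ)
open import Data.Sum using (_⊎_; inj₁; inj₂)
open import Data.Empty using (⊥; ⊥-elim)
open import Level using (0ℓ)
open import Relation.Unary using (Pred)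
open import Relation.Nullary using (¬_)
open import Relation.Binary using (tri<; tri≈; tri>)
open import Relation.Binary.PropositionalEquality
open import Function.Bundles using (Equivalence; _⇔_; Injection)
open import Function.Properties.Inverse using (↔⇒↣)

≐-refl : {D : Pred Square 0ℓ} → D ≐ D
≐-refl = (λ _ d → d) , (λ _ d → d)

≐-sym : {D E : Pred Square 0ℓ} → D ≐ E → E ≐ D
≐-sym (f , g) = g , f

≐-trans : {D E F : Pred Square 0ℓ} → D ≐ E → E ≐ F → D ≐ F
≐-trans (f , g) (f' , g') = (λ s d → f' s (f s d)) , (λ s d → g s (g' s d))

≐-via : {D₁ D₂ X₁ X₂ : Pred Square 0ℓ} → D₁ ≐ X₁ → X₁ ≐ X₂ → D₂ ≐ X₂ → D₁ ≐ D₂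
≐-via E₁ X E₂ = ≐-trans E₁ (≐-trans X (≐-sym E₂))

record Run (F : ℕ → Set) (s c : ℕ) : Set where
  constructor mkRun
  field
    window : ∀ i → i ≤ suc c → F (s + i) ⇔ ((1 ≤ i) × (i ≤ c))

  inside : ∀ {i} → 1 ≤ i → i ≤ c → F (s + i)
  inside 1≤i i≤c = Equivalence.from (window _ (m≤n⇒m≤1+n i≤c)) (1≤i , i≤c)

  outside : ∀ {i} → i ≤ suc c → F (s + i) → (1 ≤ i) × (i ≤ c)
  outside i≤1+c = Equivalence.to (window _ i≤1+c)

run-transport : ∀ {F H : ℕ → Set} {s t c} →
  (∀ i → H (t + i) ≡ F (s + i)) → Run H t c → Run F s c
run-transport {c = c} e (mkRun window) =
  mkRun (λ i le → subst (λ X → X ⇔ ((1 ≤ i) × (i ≤ c))) (e i) (window i le))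

-- Two runs with the same starting point have the same length: otherwise the
-- right end of the shorter one lies strictly inside the longer one.
run-length : ∀ {F s c c'} → Run F s c → Run F s c' → c ≡ c'
run-length {c = c} {c'} r r' with <-cmp c c'
... | tri< c<c' _ _ = ⊥-elim (1+n≰n (proj₂ (Run.outside r ≤-refl (Run.inside r' (s≤s z≤n) c<c'))))
... | tri≈ _ c≡c' _ = c≡c'
... | tri> _ _ c>c' = ⊥-elim (1+n≰n (proj₂ (Run.outside r' ≤-refl (Run.inside r (s≤s z≤n) c>c'))))

-- A run cannot start strictly inside another run (its start point must fail F),
-- so two runs of which the second starts within the first coincide.
run-unique : ∀ {F s d c c'} → Run F s c → Run F (s + d) c' → d ≤ c →
  (d ≡ 0) × (c ≡ c')
run-unique {F} {s} {zero} r r' _ =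
  refl , run-length r (run-transport (λ i → cong (λ t → F (t + i)) (+-identityʳ s)) r')
run-unique {F} {s} {suc d} r r' d<c
  with Run.outside r' z≤n (subst F (sym (+-identityʳ (s + suc d))) (Run.inside r (s≤s z≤n) d<c))
... | () , _

offset : ∀ {a₁ a₂ i₁ i₂} → a₁ ≤ a₂ → a₁ + i₁ ≡ a₂ + i₂ →
  Σ ℕ λ d → (a₂ ≡ a₁ + d) × (i₁ ≡ d + i₂)
offset {a₁} {i₁ = i₁} {i₂} a₁≤a₂ e with m≤n⇒∃[o]m+o≡n a₁≤a₂
... | d , refl = d , refl , +-cancelˡ-≡ a₁ i₁ (d + i₂) (trans e (+-assoc a₁ d i₂))

module _ {k : ℕ} (p : Permutation′ k) where

  private
    G : ℕ → ℕ → Set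
    G = InGraph p

  graph-functional : ∀ {x y y'} → G x y → G x y' → y ≡ y'
  graph-functional (i , refl , refl) (j , x≡ , refl) =
    cong (λ t → suc (toℕ (p ⟨$⟩ʳ t))) (toℕ-injective (suc-injective x≡))

  graph-injective : ∀ {x x' y} → G x y → G x' y → x ≡ x'
  graph-injective (i , refl , refl) (j , refl , y≡) =
    cong (λ t → suc (toℕ t))
      (Injection.injective (↔⇒↣ p) (toℕ-injective (suc-injective y≡)))

  NECorner : ℕ → ℕ → Set
  NECorner x y = G x y ⊎ G (suc x) (suc y)

  SECorner : ℕ → ℕ → Set
  SECorner x y = G x (suc y) ⊎ G (suc x) y

  -- No square has both: the two points would share a row or a column.
  corners-clash : ∀ {x y} → NECorner x y → SECorner x y → ⊥
  corners-clash (inj₁ g) (inj₁ h) = 1+n≢n (sym (graph-functional g h))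
  corners-clash (inj₁ g) (inj₂ h) = 1+n≢n (sym (graph-injective g h))
  corners-clash (inj₂ g) (inj₁ h) = 1+n≢n (graph-injective g h)
  corners-clash (inj₂ g) (inj₂ h) = 1+n≢n (graph-functional g h)

  module _ {R : Shading k} where

    ne-run : ∀ {a b c} → IsEnclosedNE (p , R) a b c → Run (λ t → G (a + t) (b + t)) 0 c
    ne-run (_ , _ , window) = mkRun window

    se-run : ∀ {a b c} → IsEnclosedSE (p , R) a b c → Run (λ t → G (a + t) (suc b ∸ t)) 0 c
    se-run (_ , _ , _ , window) = mkRun window

    -- Square i of an enclosed NE-diagonal has graph point (a+i, b+i) when
    -- i ≥ 1, and (a+1, b+1) when i = 0.
    ne-corner : ∀ {a b c x y} → IsEnclosedNE (p , R) a b c → NESet a b c (x , y) → NECorner x y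
    ne-corner {a} {b} ne@(1≤c , _) (zero , _ , refl , refl) =
      inj₂ (subst₂ G (+-suc a 0) (+-suc b 0) (Run.inside (ne-run ne) ≤-refl 1≤c))
    ne-corner ne (suc j , j<c , refl , refl) =
      inj₁ (Run.inside (ne-run ne) (s≤s z≤n) j<c)

    -- Square i of an enclosed SE-diagonal, the square (a+i, y) with y+i = b,
    -- has graph point (a+i, y+1) when i ≥ 1, and (a+1, y) when i = 0.
    se-corner : ∀ {a b c x y} → IsEnclosedSE (p , R) a b c → SESet a b c (x , y) → SECorner x y
    se-corner {a} {y = y} se@(1≤c , _) (zero , _ , refl , refl) =
      inj₂ (subst₂ G (+-suc a 0) (+-identityʳ y) (Run.inside (se-run se) ≤-refl 1≤c))
    se-corner {y = y} se (suc j , j<c , refl , refl) =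
      inj₁ (subst (G _) (m+n∸n≡m (suc y) (suc j))
              (Run.inside (se-run se) (s≤s z≤n) j<c))

    pointless-ne : ∀ {a b x y} → IsPointless (p , R) a b → Singleton a b (x , y) → ¬ NECorner x y
    pointless-ne (_ , ¬g₀₀ , _ , _ , _) (refl , refl) (inj₁ g) = ¬g₀₀ g
    pointless-ne (_ , _ , _ , _ , ¬g₁₁) (refl , refl) (inj₂ g) = ¬g₁₁ g

    pointless-se : ∀ {a b x y} → IsPointless (p , R) a b → Singleton a b (x , y) → ¬ SECorner x y
    pointless-se (_ , _ , _ , ¬g₀₁ , _) (refl , refl) (inj₁ g) = ¬g₀₁ g
    pointless-se (_ , _ , ¬g₁₀ , _ , _) (refl , refl) (inj₂ g) = ¬g₁₀ g

    -- Along the line of an enclosed NE-diagonal, an enclosed NE-diagonal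
    -- starting d ≤ c₁ steps later is a run starting inside the first run, so
    -- the two coincide.
    ne-shifted : ∀ {a b c₁ c₂ d} → IsEnclosedNE (p , R) a b c₁ →
      IsEnclosedNE (p , R) (a + d) (b + d) c₂ → d ≤ c₁ →
      NESet a b c₁ ≐ NESet (a + d) (b + d) c₂
    ne-shifted {a} {b} {c₁} {d = d} ne₁ ne₂ d≤c₁
      with run-unique {d = d} (ne-run ne₁)
             (run-transport (λ i → cong₂ G (+-assoc a d i) (+-assoc b d i)) (ne-run ne₂)) d≤c₁
    ... | refl , refl = subst₂ (λ a' b' → NESet a b c₁ ≐ NESet a' b' c₁)
                          (sym (+-identityʳ a)) (sym (+-identityʳ b)) ≐-refl

    -- Two enclosed NE-diagonals through a common square, the first starting
    -- no later than the second: the second is shifted by d = a₂ - a₁ ≤ c₁.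
    ne-unique-≤ : ∀ {a₁ b₁ c₁ a₂ b₂ c₂ s} → a₁ ≤ a₂ →
      IsEnclosedNE (p , R) a₁ b₁ c₁ → IsEnclosedNE (p , R) a₂ b₂ c₂ →
      NESet a₁ b₁ c₁ s → NESet a₂ b₂ c₂ s → NESet a₁ b₁ c₁ ≐ NESet a₂ b₂ c₂
    ne-unique-≤ {b₁ = b₁} {b₂ = b₂} a₁≤a₂ ne₁ ne₂ (i₁ , i₁≤c₁ , refl , refl) (i₂ , _ , x≡ , y≡)
      with offset a₁≤a₂ x≡
    ... | d , refl , refl
      with +-cancelʳ-≡ i₂ (b₁ + d) b₂ (trans (+-assoc b₁ d i₂) y≡)
    ... | refl = ne-shifted ne₁ ne₂ (m+n≤o⇒m≤o d i₁≤c₁)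

    ne-unique : ∀ {a₁ b₁ c₁ a₂ b₂ c₂ s} → IsEnclosedNE (p , R) a₁ b₁ c₁ → IsEnclosedNE (p , R) a₂ b₂ c₂ →
      NESet a₁ b₁ c₁ s → NESet a₂ b₂ c₂ s → NESet a₁ b₁ c₁ ≐ NESet a₂ b₂ c₂
    ne-unique {a₁} {a₂ = a₂} ne₁ ne₂ m₁ m₂ with ≤-total a₁ a₂
    ... | inj₁ a₁≤a₂ = ne-unique-≤ a₁≤a₂ ne₁ ne₂ m₁ m₂
    ... | inj₂ a₂≤a₁ = ≐-sym (ne-unique-≤ a₂≤a₁ ne₂ ne₁ m₂ m₁)

    se-shifted : ∀ {a b c₁ c₂ d} → IsEnclosedSE (p , R) a (b + d) c₁ →
      IsEnclosedSE (p , R) (a + d) b c₂ → d ≤ c₁ →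
      SESet a (b + d) c₁ ≐ SESet (a + d) b c₂
    se-shifted {a} {b} {c₁} {d = d} se₁ se₂ d≤c₁
      with run-unique {d = d} (se-run se₁)
             (run-transport (λ i → cong₂ G (+-assoc a d i) (sym (row i))) (se-run se₂)) d≤c₁
      where
      row : ∀ i → suc (b + d) ∸ (d + i) ≡ suc b ∸ i
      row i = begin
        suc (b + d) ∸ (d + i) ≡⟨ cong (_∸ (d + i)) (+-comm (suc b) d) ⟩
        (d + suc b) ∸ (d + i) ≡⟨ [m+n]∸[m+o]≡n∸o d (suc b) i ⟩
        suc b ∸ i             ∎
        where open ≡-Reasoning
    ... | refl , refl = subst₂ (λ a' b' → SESet a b' c₁ ≐ SESet a' b c₁)
                          (sym (+-identityʳ a)) (sym (+-identityʳ b)) ≐-refl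

    -- Two enclosed SE-diagonals through a common square (x, y), the first
    -- starting no later than the second: the second is shifted by
    -- d = a₂ - a₁ ≤ c₁, and the first starts d rows higher.
    se-unique-≤ : ∀ {a₁ b₁ c₁ a₂ b₂ c₂ s} → a₁ ≤ a₂ →
      IsEnclosedSE (p , R) a₁ b₁ c₁ → IsEnclosedSE (p , R) a₂ b₂ c₂ →
      SESet a₁ b₁ c₁ s → SESet a₂ b₂ c₂ s → SESet a₁ b₁ c₁ ≐ SESet a₂ b₂ c₂
    se-unique-≤ {a₁} {c₁ = c₁} {c₂ = c₂} {s = _ , y} a₁≤a₂ se₁ se₂
                (i₁ , i₁≤c₁ , refl , refl) (i₂ , _ , x≡ , refl)
      with offset a₁≤a₂ x≡
    ... | d , refl , refl =
      subst (λ b₁ → SESet a₁ b₁ c₁ ≐ SESet (a₁ + d) (y + i₂) c₂) (sym rows-apart)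
        (se-shifted (subst (λ b₁ → IsEnclosedSE (p , R) a₁ b₁ c₁) rows-apart se₁) se₂
          (m+n≤o⇒m≤o d i₁≤c₁))
      where
      rows-apart : y + (d + i₂) ≡ (y + i₂) + d
      rows-apart = trans (cong (y +_) (+-comm d i₂)) (sym (+-assoc y i₂ d))

    se-unique : ∀ {a₁ b₁ c₁ a₂ b₂ c₂ s} → IsEnclosedSE (p , R) a₁ b₁ c₁ → IsEnclosedSE (p , R) a₂ b₂ c₂ →
      SESet a₁ b₁ c₁ s → SESet a₂ b₂ c₂ s → SESet a₁ b₁ c₁ ≐ SESet a₂ b₂ c₂
    se-unique {a₁} {a₂ = a₂} se₁ se₂ m₁ m₂ with ≤-total a₁ a₂
    ... | inj₁ a₁≤a₂ = se-unique-≤ a₁≤a₂ se₁ se₂ m₁ m₂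
    ... | inj₂ a₂≤a₁ = ≐-sym (se-unique-≤ a₂≤a₁ se₂ se₁ m₂ m₁)

    enclosed-unique : (s : Square) (D₁ D₂ : Pred Square 0ℓ) →
      EnclosedDiagonal (p , R) D₁ → EnclosedDiagonal (p , R) D₂ → D₁ s → D₂ s → D₁ ≐ D₂
    enclosed-unique s D₁ D₂ (inj₁ (_ , _ , _ , ne₁ , E₁)) (inj₁ (_ , _ , _ , ne₂ , E₂)) m₁ m₂ =
      ≐-via E₁ (ne-unique ne₁ ne₂ (proj₁ E₁ s m₁) (proj₁ E₂ s m₂)) E₂
    enclosed-unique s D₁ D₂ (inj₂ (inj₁ (_ , _ , _ , se₁ , E₁))) (inj₂ (inj₁ (_ , _ , _ , se₂ , E₂))) m₁ m₂ =
      ≐-via E₁ (se-unique se₁ se₂ (proj₁ E₁ s m₁) (proj₁ E₂ s m₂)) E₂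
    enclosed-unique (_ , _) D₁ D₂ (inj₂ (inj₂ (_ , _ , _ , E₁))) (inj₂ (inj₂ (_ , _ , _ , E₂))) m₁ m₂
      with proj₁ E₁ _ m₁ | proj₁ E₂ _ m₂
    ... | refl , refl | refl , refl = ≐-via E₁ ≐-refl E₂
    enclosed-unique s D₁ D₂ (inj₁ (_ , _ , _ , ne , E₁)) (inj₂ (inj₁ (_ , _ , _ , se , E₂))) m₁ m₂ =
      ⊥-elim (corners-clash (ne-corner ne (proj₁ E₁ s m₁)) (se-corner se (proj₁ E₂ s m₂)))
    enclosed-unique s D₁ D₂ (inj₂ (inj₁ (_ , _ , _ , se , E₁))) (inj₁ (_ , _ , _ , ne , E₂)) m₁ m₂ =
      ⊥-elim (corners-clash (ne-corner ne (proj₁ E₂ s m₂)) (se-corner se (proj₁ E₁ s m₁)))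
    enclosed-unique s D₁ D₂ (inj₁ (_ , _ , _ , ne , E₁)) (inj₂ (inj₂ (_ , _ , pt , E₂))) m₁ m₂ =
      ⊥-elim (pointless-ne pt (proj₁ E₂ s m₂) (ne-corner ne (proj₁ E₁ s m₁)))
    enclosed-unique s D₁ D₂ (inj₂ (inj₂ (_ , _ , pt , E₁))) (inj₁ (_ , _ , _ , ne , E₂)) m₁ m₂ =
      ⊥-elim (pointless-ne pt (proj₁ E₁ s m₁) (ne-corner ne (proj₁ E₂ s m₂)))
    enclosed-unique s D₁ D₂ (inj₂ (inj₁ (_ , _ , _ , se , E₁))) (inj₂ (inj₂ (_ , _ , pt , E₂))) m₁ m₂ =
      ⊥-elim (pointless-se pt (proj₁ E₂ s m₂) (se-corner se (proj₁ E₁ s m₁)))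
    enclosed-unique s D₁ D₂ (inj₂ (inj₂ (_ , _ , pt , E₁))) (inj₂ (inj₁ (_ , _ , _ , se , E₂))) m₁ m₂ =
      ⊥-elim (pointless-se pt (proj₁ E₁ s m₁) (se-corner se (proj₁ E₂ s m₂)))

inR-mono : ∀ {k} {R R' : Shading k} → R' ⊆ₛ R → ∀ {a b} → InR R' a b → InR R a b
inR-mono R'⊆R (a< , b< , e) = a< , b< , R'⊆R _ _ e

enclosed-mono : ∀ {k} (p : Permutation′ k) {R R' : Shading k} → R' ⊆ₛ R →
  (D : Pred Square 0ℓ) → EnclosedDiagonal (p , R') D → EnclosedDiagonal (p , R) D
enclosed-mono p R'⊆R D (inj₁ (a , b , c , (1≤c , inR , run) , E)) =
  inj₁ (a , b , c , (1≤c , (λ i le → inR-mono R'⊆R (inR i le)) , run) , E)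
enclosed-mono p R'⊆R D (inj₂ (inj₁ (a , b , c , (1≤c , c≤b , inR , run) , E))) =
  inj₂ (inj₁ (a , b , c , (1≤c , c≤b , (λ i le → inR-mono R'⊆R (inR i le)) , run) , E))
enclosed-mono p R'⊆R D (inj₂ (inj₂ (a , b , (inR , noCorner) , E))) =
  inj₂ (inj₂ (a , b , (inR-mono R'⊆R inR , noCorner) , E))

lemma3p3 : ((k : ℕ) (p : Permutation′ k) (R R' : Shading k) → R' ⊆ₛ R →
    (D : Pred Square 0ℓ) → EnclosedDiagonal (p , R') D → EnclosedDiagonal (p , R) D)
    ×
    ((k : ℕ) (p : Permutation′ k) (R : Shading k) (a b : ℕ) → InR R a b →
    (D₁ D₂ : Pred Square 0ℓ) →
    EnclosedDiagonal (p , R) D₁ → EnclosedDiagonal (p , R) D₂ →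
    D₁ (a , b) → D₂ (a , b) → D₁ ≐ D₂)
lemma3p3 =
  (λ k p R R' R'⊆R → enclosed-mono p {R} {R'} R'⊆R) ,
  (λ k p R a b _ → enclosed-unique p {R} (a , b))
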